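{- Let $G$ be a graph of order $n$ with $\gamma_i(G)\ge 2$. Then $st_{id}(G)\le \dfrac{n}{\gamma_i(G)}$.
   Context: All graphs are finite and simple. An independent dominating set of a graph $G$ is a set $S\subseteq V(G)$ of pairwise non-adjacent vertices such that every vertex not in $S$ has a neighbour in $S$. The independent domination number $\gamma_i(G)$ is the minimum size of an independent dominating set (for the null graph with no vertices, $\gamma_i=0$). The independent domination stability $st_{id}(G)$ is the minimum number of vertices whose removal from $G$ yields a graph with independent domination number different from $\gamma_i(G)$. -}

module Defs where

open import Data.Nat using (ℕ; _≤_)
open import Data.Bool using (Bool; true; false)
open import Data.Fin using (Fin)
open import Data.Fin.Subset using (Subset; _∈_; _∉_; _⊆_; ∣_∣; _─_; ⊤)
open import Data.Product using (Σ; _×_; ∃; ∃-syntax)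
open import Relation.Binary.PropositionalEquality using (_≡_; _≢_)

record Graph (n : ℕ) : Set where
  field
    adj    : Fin n → Fin n → Bool
    sym    : ∀ u v → adj u v ≡ adj v u
    irrefl : ∀ v → adj v v ≡ false
open Graph public

-- S is an independent dominating set of the induced subgraph G[W].
IsIndDom : ∀ {n} → Graph n → Subset n → Subset n → Set
IsIndDom G W S =
  S ⊆ W
  × (∀ u v → u ∈ S → v ∈ S → adj G u v ≡ false)
  × (∀ v → v ∈ W → v ∉ S → ∃[ u ] (u ∈ S × adj G u v ≡ true))

-- k = γ_i(G[W]) : minimum size of an independent dominating set of G[W]
-- (for W empty this is 0, witnessed by the empty set).
IsIndDomNumber : ∀ {n} → Graph n → Subset n → ℕ → Set
IsIndDomNumber G W k =
  (∃[ S ] (IsIndDom G W S × ∣ S ∣ ≡ k))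
  × (∀ S → IsIndDom G W S → k ≤ ∣ S ∣)

ChangesIndDom : ∀ {n} → Graph n → Subset n → Set
ChangesIndDom G R =
  ∀ k k' → IsIndDomNumber G ⊤ k → IsIndDomNumber G (⊤ ─ R) k' → k' ≢ k

IsIndDomStability : ∀ {n} → Graph n → ℕ → Set
IsIndDomStability G s =
  (∃[ R ] (ChangesIndDom G R × ∣ R ∣ ≡ s))
  × (∀ R → ChangesIndDom G R → s ≤ ∣ R ∣)

-- A minimum independent dominating set S assigns every vertex outside S to a
-- dominator in S, splitting V(G) into γ stars, one around each v ∈ S.  Deleting
-- the star of v leaves S - v independent and dominating, so γ_i drops below γ;
-- hence every star has at least st_id(G) vertices, and summing over the γ stars
-- gives st_id(G) · γ ≤ n.
module Submission where

open import Defs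
open import Data.Nat using (ℕ; _≤_; _*_)
open import Data.Fin.Subset using (⊤)

open import Data.Bool using (Bool; true; false)
open import Data.Fin using (Fin; zero; suc)
open import Data.Fin.Subset
  using (Subset; inside; outside; _∈_; _∉_; _⊆_; ∣_∣; _─_; _-_; ⁅_⁆)
open import Data.Fin.Subset.Properties
  using (_∈?_; ∈⊤; x∈⁅x⁆; x∈⁅y⁆⇒x≡y; ∣⁅x⁆∣≡1; ∣⊤∣≡n; p─q⊆p; x∈p∧x∉q⇒x∈p─q;
         x∈p∧x≢y⇒x∈p-y; x∈p⇒∣p-x∣<∣p∣)
open import Data.Nat using (zero; suc; _<_; z≤n)
open import Data.Nat.Properties
  using (+-*-semiring; +-mono-≤; *-zeroʳ; *-identityʳ; <-irrefl; module ≤-Reasoning)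
open import Algebra.Properties.Semiring.Sum +-*-semiring
  using (sum; sum-syntax; sum-cong-≗; ∑-comm; *-distribˡ-sum)
open import Data.Product using (_×_; _,_; proj₁; proj₂; ∃-syntax)
open import Data.Vec using ([]; _∷_; here; there; lookup; tabulate)
open import Data.Vec.Functional using (Vector)
open import Data.Vec.Properties using (lookup∘tabulate; lookup-replicate; []=⇒lookup; lookup⇒[]=)
open import Relation.Binary.PropositionalEquality as ≡
  using (_≡_; _≢_; refl; trans; cong; module ≡-Reasoning)
open import Function using (_∘_)
open import Relation.Nullary using (yes; no; contradiction)

𝟙 : Bool → ℕ
𝟙 true  = 1
𝟙 false = 0

∣p∣≡∑𝟙 : ∀ {n} (p : Subset n) → ∣ p ∣ ≡ ∑[ i < n ] 𝟙 (lookup p i)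
∣p∣≡∑𝟙 []            = refl
∣p∣≡∑𝟙 (inside  ∷ p) = cong suc (∣p∣≡∑𝟙 p)
∣p∣≡∑𝟙 (outside ∷ p) = ∣p∣≡∑𝟙 p

∑-mono-≤ : ∀ {n} {f g : Vector ℕ n} → (∀ i → f i ≤ g i) → sum f ≤ sum g
∑-mono-≤ {zero}  f≤g = z≤n
∑-mono-≤ {suc n} f≤g = +-mono-≤ (f≤g zero) (∑-mono-≤ (f≤g ∘ suc))

∑1≡n : ∀ n → ∑[ i < n ] 1 ≡ n
∑1≡n n = begin
  ∑[ i < n ] 1                  ≡⟨ sum-cong-≗ (λ i → cong 𝟙 (≡.sym (lookup-replicate {n = n} i inside))) ⟩
  ∑[ i < n ] 𝟙 (lookup ⊤ i)     ≡⟨ ≡.sym (∣p∣≡∑𝟙 (⊤ {n})) ⟩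
  ∣ ⊤ {n} ∣                     ≡⟨ ∣⊤∣≡n n ⟩
  n                             ∎
  where open ≡-Reasoning

x∈p─q⇒x∉q : ∀ {n} {x : Fin n} (p q : Subset n) → x ∈ p ─ q → x ∉ q
x∈p─q⇒x∉q (_ ∷ p) (outside ∷ q) here       ()
x∈p─q⇒x∉q (_ ∷ p) (_       ∷ q) (there x∈) (there x∈q) = x∈p─q⇒x∉q p q x∈ x∈q

x∈p-y⇒x≢y : ∀ {n} {x y : Fin n} (p : Subset n) → x ∈ p - y → x ≢ y
x∈p-y⇒x≢y {y = y} p x∈p-y refl = x∈p─q⇒x∉q p ⁅ y ⁆ x∈p-y (x∈⁅x⁆ y)

fiber : ∀ {n m} → (Fin n → Fin m) → Fin m → Subset n
fiber f v = tabulate (λ u → lookup ⁅ f u ⁆ v)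

module _ {n m} (f : Fin n → Fin m) where

  ∈-fiber⁺ : ∀ {u v} → f u ≡ v → u ∈ fiber f v
  ∈-fiber⁺ {u} refl = lookup⇒[]= u (fiber f (f u))
    (trans (lookup∘tabulate _ u) ([]=⇒lookup (x∈⁅x⁆ (f u))))

  ∈-fiber⁻ : ∀ {u v} → u ∈ fiber f v → f u ≡ v
  ∈-fiber⁻ {u} {v} u∈fiber = ≡.sym (x∈⁅y⁆⇒x≡y (f u) (lookup⇒[]= v ⁅ f u ⁆
    (trans (≡.sym (lookup∘tabulate _ u)) ([]=⇒lookup u∈fiber))))

  ∑∣fiber∣≡n : ∑[ v < m ] ∣ fiber f v ∣ ≡ n
  ∑∣fiber∣≡n = begin
    ∑[ v < m ] ∣ fiber f v ∣                    ≡⟨ sum-cong-≗ ∣fiber∣≡∑ ⟩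
    ∑[ v < m ] ∑[ u < n ] 𝟙 (lookup ⁅ f u ⁆ v)  ≡⟨ ∑-comm (λ v u → 𝟙 (lookup ⁅ f u ⁆ v)) ⟩
    ∑[ u < n ] ∑[ v < m ] 𝟙 (lookup ⁅ f u ⁆ v)  ≡⟨ sum-cong-≗ (λ u → ≡.sym (∣p∣≡∑𝟙 ⁅ f u ⁆)) ⟩
    ∑[ u < n ] ∣ ⁅ f u ⁆ ∣                      ≡⟨ sum-cong-≗ (∣⁅x⁆∣≡1 ∘ f) ⟩
    ∑[ u < n ] 1                                ≡⟨ ∑1≡n n ⟩
    n                                           ∎
    where
    open ≡-Reasoning
    ∣fiber∣≡∑ : ∀ v → ∣ fiber f v ∣ ≡ ∑[ u < n ] 𝟙 (lookup ⁅ f u ⁆ v)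
    ∣fiber∣≡∑ v = trans (∣p∣≡∑𝟙 (fiber f v)) (sum-cong-≗ (cong 𝟙 ∘ lookup∘tabulate (λ u → lookup ⁅ f u ⁆ v)))

  large-fibers⇒s*∣S∣≤n : ∀ {s} (S : Subset m) → (∀ v → v ∈ S → s ≤ ∣ fiber f v ∣) → s * ∣ S ∣ ≤ n
  large-fibers⇒s*∣S∣≤n {s} S large = begin
    s * ∣ S ∣                       ≡⟨ cong (s *_) (∣p∣≡∑𝟙 S) ⟩
    s * ∑[ v < m ] 𝟙 (lookup S v)   ≡⟨ *-distribˡ-sum s (𝟙 ∘ lookup S) ⟩
    ∑[ v < m ] (s * 𝟙 (lookup S v)) ≤⟨ ∑-mono-≤ bound ⟩
    ∑[ v < m ] ∣ fiber f v ∣        ≡⟨ ∑∣fiber∣≡n ⟩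
    n                               ∎
    where
    open ≤-Reasoning
    bound : ∀ v → s * 𝟙 (lookup S v) ≤ ∣ fiber f v ∣
    bound v with lookup S v in S[v]
    ... | outside rewrite *-zeroʳ s     = z≤n
    ... | inside  rewrite *-identityʳ s = large v (lookup⇒[]= v S S[v])

module _ {n} (G : Graph n) {S : Subset n} (S-indDom : IsIndDom G ⊤ S) where

  private
    S-independent = proj₁ (proj₂ S-indDom)
    S-dominating  = proj₂ (proj₂ S-indDom)

  dominator : Fin n → Fin n
  dominator u with u ∈? S
  ... | yes _   = u
  ... | no  u∉S = proj₁ (S-dominating u ∈⊤ u∉S)

  dominator-∈ : ∀ u → dominator u ∈ S
  dominator-∈ u with u ∈? S
  ... | yes u∈S = u∈S
  ... | no  u∉S = proj₁ (proj₂ (S-dominating u ∈⊤ u∉S))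

  dominator-fixes : ∀ {u} → u ∈ S → dominator u ≡ u
  dominator-fixes {u} u∈S with u ∈? S
  ... | yes _   = refl
  ... | no  u∉S = contradiction u∈S u∉S

  dominator-adj : ∀ {u} → u ∉ S → adj G (dominator u) u ≡ true
  dominator-adj {u} u∉S with u ∈? S
  ... | yes u∈S = contradiction u∈S u∉S
  ... | no  u∉S = proj₂ (proj₂ (S-dominating u ∈⊤ u∉S))

  star : Fin n → Subset n
  star = fiber dominator

  IsIndDom-without-star : ∀ {v} → v ∈ S → IsIndDom G (⊤ ─ star v) (S - v)
  IsIndDom-without-star {v} v∈S = S-v⊆ , independent , dominating
    where
    S-v⊆S : S - v ⊆ S
    S-v⊆S = p─q⊆p S ⁅ v ⁆

    S-v⊆ : S - v ⊆ ⊤ ─ star v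
    S-v⊆ {u} u∈S-v = x∈p∧x∉q⇒x∈p─q ∈⊤ λ u∈star →
      x∈p-y⇒x≢y S u∈S-v (trans (≡.sym (dominator-fixes (S-v⊆S u∈S-v))) (∈-fiber⁻ dominator u∈star))

    independent : ∀ u w → u ∈ S - v → w ∈ S - v → adj G u w ≡ false
    independent u w u∈ w∈ = S-independent u w (S-v⊆S u∈) (S-v⊆S w∈)

    dominating : ∀ u → u ∈ ⊤ ─ star v → u ∉ S - v → ∃[ w ] (w ∈ S - v × adj G w u ≡ true)
    dominating u u∈ u∉S-v with u ∈? S
    ... | yes u∈S = contradiction (x∈p∧x≢y⇒x∈p-y u∈S (u∉star ∘ trans (dominator-fixes u∈S))) u∉S-v
      where u∉star = x∈p─q⇒x∉q ⊤ (star v) u∈ ∘ ∈-fiber⁺ dominator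
    ... | no  u∉S = dominator u , x∈p∧x≢y⇒x∈p-y (dominator-∈ u) u∉star , dominator-adj u∉S
      where u∉star = x∈p─q⇒x∉q ⊤ (star v) u∈ ∘ ∈-fiber⁺ dominator

smaller-IsIndDom⇒ChangesIndDom : ∀ {n} (G : Graph n) {γ R T} → IsIndDomNumber G ⊤ γ →
                                 IsIndDom G (⊤ ─ R) T → ∣ T ∣ < γ → ChangesIndDom G R
smaller-IsIndDom⇒ChangesIndDom G {γ} {T = T} (_ , γ-min) T-indDom ∣T∣<γ k k' ((Sₖ , Sₖ-indDom , ∣Sₖ∣≡k) , _) (_ , k'-min) k'≡k =
  <-irrefl refl (begin-strict
    k      ≡⟨ ≡.sym k'≡k ⟩
    k'     ≤⟨ k'-min T T-indDom ⟩
    ∣ T ∣  <⟨ ∣T∣<γ ⟩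
    γ      ≤⟨ γ-min Sₖ Sₖ-indDom ⟩
    ∣ Sₖ ∣ ≡⟨ ∣Sₖ∣≡k ⟩
    k      ∎)
  where open ≤-Reasoning

mainTheorem9 : (n : ℕ) (G : Graph n) (γ s : ℕ)
    → IsIndDomNumber G ⊤ γ
    → 2 ≤ γ
    → IsIndDomStability G s
    → s * γ ≤ n
mainTheorem9 n G γ s γ-number@((S , S-indDom , ∣S∣≡γ) , _) _ (_ , s-min) = begin
  s * γ      ≡⟨ cong (s *_) (≡.sym ∣S∣≡γ) ⟩
  s * ∣ S ∣  ≤⟨ large-fibers⇒s*∣S∣≤n (dominator G S-indDom) S large-stars ⟩
  n          ∎
  where
  open ≤-Reasoning
  large-stars : ∀ v → v ∈ S → s ≤ ∣ star G S-indDom v ∣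
  large-stars v v∈S = s-min (star G S-indDom v)
    (smaller-IsIndDom⇒ChangesIndDom G γ-number (IsIndDom-without-star G S-indDom v∈S)
      (≡.subst (∣ S - v ∣ <_) ∣S∣≡γ (x∈p⇒∣p-x∣<∣p∣ v∈S)))
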